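{- Every $\cap$-edge simplicial graph is split.
   Context: A clique $K$ of $G$ is simplicial if $K=N[v]$ for some vertex $v$ (closed neighborhood); a graph is edge simplicial if every edge lies in a simplicial clique; $G$ is $\cap$-edge simplicial if both $G$ and its complement $\overline{G}$ are edge simplicial. A graph is split if its vertex set can be partitioned into a clique and a stable set. -}

module Defs where

open import Data.Nat using (ℕ)
open import Data.Fin using (Fin)
open import Data.Fin.Subset using (Subset; _∈_; _∉_; ∁)
open import Data.Bool using (Bool; true; false; not; _∧_)
open import Data.Product using (Σ; _×_; ∃)
open import Data.Sum using (_⊎_)
open import Relation.Nullary using (¬_)
open import Relation.Binary.PropositionalEquality using (_≡_; _≢_)
open import Relation.Nullary.Decidable using (⌊_⌋)
open import Data.Fin using (_≟_)

record Graph (n : ℕ) : Set where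
  field
    adj     : Fin n → Fin n → Bool
    symm    : ∀ u v → adj u v ≡ adj v u
    irrefl  : ∀ v → adj v v ≡ false
open Graph public

Adj : {n : ℕ} → Graph n → Fin n → Fin n → Set
Adj G u v = adj G u v ≡ true

complement : {n : ℕ} → Graph n → Graph n
complement {n} G = record
  { adj = λ u v → not (adj G u v) ∧ not ⌊ u ≟ v ⌋
  ; symm = sy
  ; irrefl = ir
  }
  where
  open import Relation.Binary.PropositionalEquality using (refl; sym; cong₂; cong)
  open import Relation.Nullary using (yes; no)
  sy : ∀ u v → (not (adj G u v) ∧ not ⌊ u ≟ v ⌋) ≡ (not (adj G v u) ∧ not ⌊ v ≟ u ⌋)
  sy u v with u ≟ v | v ≟ u
  ... | yes _ | yes _ = cong₂ _∧_ (cong not (symm G u v)) refl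
  ... | no _  | no _  = cong₂ _∧_ (cong not (symm G u v)) refl
  ... | yes p | no q  = Data.Empty.⊥-elim (q (sym p))
    where import Data.Empty
  ... | no p  | yes q = Data.Empty.⊥-elim (p (sym q))
    where import Data.Empty
  ir : ∀ v → (not (adj G v v) ∧ not ⌊ v ≟ v ⌋) ≡ false
  ir v with v ≟ v
  ... | yes _ = Data.Bool.Properties.∧-zeroʳ (not (adj G v v))
    where import Data.Bool.Properties
  ... | no ¬p = Data.Empty.⊥-elim (¬p refl)
    where import Data.Empty

IsClique : {n : ℕ} → Graph n → Subset n → Set
IsClique G K = ∀ u v → u ∈ K → v ∈ K → u ≢ v → Adj G u v

IsStable : {n : ℕ} → Graph n → Subset n → Set
IsStable G S = ∀ u v → u ∈ S → v ∈ S → ¬ Adj G u v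

IsClosedNbhd : {n : ℕ} → Graph n → Subset n → Fin n → Set
IsClosedNbhd G K v = ∀ u → (u ∈ K → (u ≡ v ⊎ Adj G v u)) × ((u ≡ v ⊎ Adj G v u) → u ∈ K)

IsSimplicialClique : {n : ℕ} → Graph n → Subset n → Set
IsSimplicialClique G K = IsClique G K × ∃ λ v → IsClosedNbhd G K v

EdgeSimplicial : {n : ℕ} → Graph n → Set
EdgeSimplicial G = ∀ u w → Adj G u w →
  ∃ λ K → IsSimplicialClique G K × u ∈ K × w ∈ K

CapEdgeSimplicial : {n : ℕ} → Graph n → Set
CapEdgeSimplicial G = EdgeSimplicial G × EdgeSimplicial (complement G)

IsSplit : {n : ℕ} → Graph n → Set
IsSplit G = ∃ λ (K : Subset _) →
  IsClique G K × IsStable G (∁ K)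

-- Call v simplicial in G when its closed neighbourhood N[v] is a clique.
-- The heart of the proof is one lemma about a single graph G:
--
--   if G and its complement Ḡ are both edge simplicial, then any two
--   distinct vertices that are NOT simplicial in G are adjacent in G.
--
-- (A non-simplicial vertex u has a neighbour, so some edge at u lies in a
-- simplicial clique N[x] with x ≠ u; if u lies in a simplicial clique N̄[y]
-- of Ḡ, then x ∉ N̄[y] forces y ∈ N[x], and then u = y.  Two non-adjacent
-- non-simplicial vertices form an edge of Ḡ, hence lie in one such N̄[y]
-- and both equal y.)
--
-- Since complementation is an involution, ∩-edge simpliciality passes to Ḡ,
-- so the same lemma says: vertices that are not simplicial in Ḡ are
-- pairwise non-adjacent in G.  Now either some vertex v is simplicial in
-- both G and Ḡ, and the partition (N[v], rest) is a split partition; or no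
-- vertex is, and (non-simplicial in G, simplicial in G) is one.
module Submission where

open import Data.Nat using (ℕ)
open import Defs
open import Level using (Level)
open import Data.Fin using (Fin; _≟_)
open import Data.Fin.Subset using (Subset; _∈_; ∁)
open import Data.Fin.Subset.Properties using (x∈∁p⇒x∉p)
open import Data.Fin.Properties using (all?; any?)
open import Data.Bool using (true; false)
import Data.Bool as Bool
open import Data.Product using (_×_; ∃; _,_; proj₁; proj₂)
open import Data.Sum using (_⊎_; inj₁; inj₂; map₂)
open import Data.Vec using (tabulate)
open import Data.Vec.Properties using ([]=⇒lookup; lookup⇒[]=; lookup∘tabulate)
open import Function using (_∘_)
open import Function.Bundles using (_⇔_; mk⇔; Equivalence)
import Function.Properties.Equivalence as ⇔
open import Relation.Nullary using (¬_; Dec; yes; no; does; contradiction)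
open import Relation.Nullary.Decidable
  using (_⊎-dec_; _×-dec_; _→-dec_; ¬?; dec-true; decidable-stable)
open import Relation.Unary using (Pred; Decidable)
open import Relation.Binary.PropositionalEquality using (_≡_; _≢_; refl; sym; trans)

private
  variable
    n : ℕ
    ℓ : Level

module _ {P : Pred (Fin n) ℓ} (P? : Decidable P) where

  select : Subset n
  select = tabulate (λ a → does (P? a))

  -- (In the 'no' case the abstracted membership equation reads false ≡ true.)
  ∈-select⁻ : ∀ {a} → a ∈ select → P a
  ∈-select⁻ {a} a∈ with P? a | trans (sym (lookup∘tabulate (λ b → does (P? b)) a)) ([]=⇒lookup a∈)
  ... | yes pa | _ = pa

  ∈-select⁺ : ∀ {a} → P a → a ∈ select
  ∈-select⁺ {a} pa = lookup⇒[]= a select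
    (trans (lookup∘tabulate (λ b → does (P? b)) a) (dec-true (P? a) pa))

  ∈∁-select⁻ : ∀ {a} → a ∈ ∁ select → ¬ P a
  ∈∁-select⁻ a∈∁ = x∈∁p⇒x∉p a∈∁ ∘ ∈-select⁺

InClosedNbhd : Graph n → Fin n → Fin n → Set
InClosedNbhd G v a = a ≡ v ⊎ Adj G v a

Simplicial : Graph n → Fin n → Set
Simplicial G v = ∀ a b → InClosedNbhd G v a → InClosedNbhd G v b → a ≢ b → Adj G a b

module _ (G : Graph n) where

  adj? : ∀ u v → Dec (Adj G u v)
  adj? u v = adj G u v Bool.≟ true

  adj-sym : ∀ {u v} → Adj G u v → Adj G v u
  adj-sym {u} {v} = trans (symm G v u)

  adj-irrefl : ∀ {u} → ¬ Adj G u u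
  adj-irrefl {u} p with () ← trans (sym p) (irrefl G u)

  adj⇒≢ : ∀ {u v} → Adj G u v → u ≢ v
  adj⇒≢ p refl = adj-irrefl p

  complement-adj⁻ : ∀ {u v} → Adj (complement G) u v → ¬ Adj G u v × u ≢ v
  complement-adj⁻ {u} {v} p with adj G u v | u ≟ v
  ... | false | no u≢v = (λ ()) , u≢v

  complement-adj⁺ : ∀ {u v} → ¬ Adj G u v → u ≢ v → Adj (complement G) u v
  complement-adj⁺ {u} {v} ¬uv u≢v with adj G u v | u ≟ v
  ... | true  | _       = contradiction refl ¬uv
  ... | false | yes u≡v = contradiction u≡v u≢v
  ... | false | no _    = refl

  complement-nonadj : ∀ {u v} → ¬ Adj (complement G) u v → u ≢ v → Adj G u v
  complement-nonadj {u} {v} ¬c u≢v with adj? u v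
  ... | yes uv  = uv
  ... | no ¬uv = contradiction (complement-adj⁺ ¬uv u≢v) ¬c

  -- Closed neighbourhoods and simpliciality are decidable (Fin n is finite);
  -- this is what lets the final case distinction be made constructively.
  inClosedNbhd? : ∀ v a → Dec (InClosedNbhd G v a)
  inClosedNbhd? v a = (a ≟ v) ⊎-dec adj? v a

  simplicial? : ∀ v → Dec (Simplicial G v)
  simplicial? v = all? λ a → all? λ b →
    inClosedNbhd? v a →-dec (inClosedNbhd? v b →-dec (¬? (a ≟ b) →-dec adj? a b))

  simplicialClique⇒simplicial : ∀ {K x} → IsClique G K → IsClosedNbhd G K x → Simplicial G x
  simplicialClique⇒simplicial Kcl Knb a b a∈ b∈ =
    Kcl a b (proj₂ (Knb a) a∈) (proj₂ (Knb b) b∈)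

  isolated⇒simplicial : ∀ {u} → (∀ a → ¬ Adj G u a) → Simplicial G u
  isolated⇒simplicial {u} isolated a b a∈ b∈ a≢b =
    contradiction (trans (only a a∈) (sym (only b b∈))) a≢b
    where
    only : ∀ c → InClosedNbhd G u c → c ≡ u
    only c (inj₁ c≡u) = c≡u
    only c (inj₂ uc)  = contradiction uc (isolated c)

  -- In an edge-simplicial graph, a non-simplicial vertex u is adjacent to
  -- some simplicial vertex x: an edge at u lies in a simplicial clique
  -- N[x], and x ≠ u because u is not simplicial.
  nonSimplicial⇒simplicialNeighbour : EdgeSimplicial G → ∀ {u} → ¬ Simplicial G u →
    ∃ λ x → Simplicial G x × Adj G x u
  nonSimplicial⇒simplicialNeighbour es {u} ¬su with any? (adj? u)
  ... | no ¬nbr = contradiction (isolated⇒simplicial (λ a ua → ¬nbr (a , ua))) ¬su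
  ... | yes (a , ua) with es u a ua
  ...   | K , (Kcl , x , Knb) , u∈K , _ with proj₁ (Knb u) u∈K
  ...     | inj₁ refl = contradiction (simplicialClique⇒simplicial Kcl Knb) ¬su
  ...     | inj₂ xu   = x , simplicialClique⇒simplicial Kcl Knb , xu

  nonSimplicial-in-coSimplicialClique : EdgeSimplicial G →
    ∀ {K y u} → IsClique (complement G) K → IsClosedNbhd (complement G) K y →
    u ∈ K → ¬ Simplicial G u → u ≡ y
  nonSimplicial-in-coSimplicialClique es {K} {y} {u} Kcl Knb u∈K ¬su
    with nonSimplicial⇒simplicialNeighbour es ¬su | u ≟ y
  ... | _ | yes u≡y = u≡y
  ... | x , sx , xu | no u≢y = contradiction yu ¬yu
    where
    -- x is G-adjacent to u ∈ K, so x cannot lie in the Ḡ-clique K …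
    x∉K : ¬ x ∈ K
    x∉K x∈K = proj₁ (complement-adj⁻ (Kcl x u x∈K u∈K (adj⇒≢ xu))) xu
    -- … hence x ∉ N̄[y], i.e. x is G-adjacent to y …
    yx : Adj G y x
    yx = complement-nonadj (x∉K ∘ proj₂ (Knb x) ∘ inj₂)
                           (x∉K ∘ proj₂ (Knb x) ∘ inj₁ ∘ sym)
    -- … so y and u both lie in the clique N[x] and are G-adjacent,
    yu : Adj G y u
    yu = sx y u (inj₂ (adj-sym yx)) (inj₂ xu) (u≢y ∘ sym)
    -- whereas u ∈ N̄[y] with u ≠ y says they are not.
    ¬yu : ¬ Adj G y u
    ¬yu with proj₁ (Knb u) u∈K
    ... | inj₁ u≡y = contradiction u≡y u≢y
    ... | inj₂ yū  = proj₁ (complement-adj⁻ yū)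

  nonSimplicial-adjacent : CapEdgeSimplicial G →
    ∀ u w → ¬ Simplicial G u → ¬ Simplicial G w → u ≢ w → Adj G u w
  nonSimplicial-adjacent (esG , esḠ) u w ¬su ¬sw u≢w with adj? u w
  ... | yes uw  = uw
  ... | no ¬uw with esḠ u w (complement-adj⁺ ¬uw u≢w)
  ...   | K , (Kcl , y , Knb) , u∈K , w∈K = contradiction
          (trans (nonSimplicial-in-coSimplicialClique esG Kcl Knb u∈K ¬su)
                 (sym (nonSimplicial-in-coSimplicialClique esG Kcl Knb w∈K ¬sw)))
          u≢w

  outside⇒complementNbhd : ∀ {v a} → ¬ InClosedNbhd G v a → InClosedNbhd (complement G) v a
  outside⇒complementNbhd {v} {a} a∉ =
    inj₂ (complement-adj⁺ (a∉ ∘ inj₂) (a∉ ∘ inj₁ ∘ sym))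

  split-by : {P : Pred (Fin n) ℓ} (P? : Decidable P) →
    (∀ a b → P a → P b → a ≢ b → Adj G a b) →
    (∀ a b → ¬ P a → ¬ P b → a ≢ b → Adj (complement G) a b) →
    IsSplit G
  split-by P? clique coclique = select P? , isClique , isStable
    where
    isClique : IsClique G (select P?)
    isClique a b a∈ b∈ = clique a b (∈-select⁻ P? a∈) (∈-select⁻ P? b∈)
    isStable : IsStable G (∁ (select P?))
    isStable a b a∈ b∈ ab = proj₁
      (complement-adj⁻ (coclique a b (∈∁-select⁻ P? a∈) (∈∁-select⁻ P? b∈) (adj⇒≢ ab)))
      ab

_≈ᴳ_ : Graph n → Graph n → Set
G ≈ᴳ H = ∀ u v → Adj G u v ⇔ Adj H u v

edgeSimplicial-resp : {G H : Graph n} → G ≈ᴳ H → EdgeSimplicial G → EdgeSimplicial H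
edgeSimplicial-resp {G = G} {H} G≈H es u w uw
  with es u w (Equivalence.from (G≈H u w) uw)
... | K , (Kcl , v , Knb) , u∈K , w∈K = K , (Kcl′ , v , Knb′) , u∈K , w∈K
  where
  Kcl′ : IsClique H K
  Kcl′ a b a∈ b∈ a≢b = Equivalence.to (G≈H a b) (Kcl a b a∈ b∈ a≢b)
  Knb′ : IsClosedNbhd H K v
  Knb′ a = map₂ (Equivalence.to (G≈H v a)) ∘ proj₁ (Knb a)
         , proj₂ (Knb a) ∘ map₂ (Equivalence.from (G≈H v a))

complement-involutive : (G : Graph n) → complement (complement G) ≈ᴳ G
complement-involutive G u v = mk⇔
  (λ c̄c̄ → let ¬c , u≢v = complement-adj⁻ (complement G) c̄c̄
           in complement-nonadj G ¬c u≢v)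
  (λ uv → complement-adj⁺ (complement G)
            (λ c → proj₁ (complement-adj⁻ G c) uv) (adj⇒≢ G uv))

capEdgeSimplicial-complement : {G : Graph n} → CapEdgeSimplicial G → CapEdgeSimplicial (complement G)
capEdgeSimplicial-complement {G = G} (esG , esḠ) =
  esḠ , edgeSimplicial-resp {G = G} {H = complement (complement G)}
          (λ u v → ⇔.sym (complement-involutive G u v)) esG

-- Either some v is simplicial in both G and Ḡ, and we split along N[v];
-- or none is, and we split into the non-simplicial vertices of G and the
-- simplicial ones, which are then non-simplicial in Ḡ.
proposition27 : (n : ℕ) (G : Graph n) → CapEdgeSimplicial G → IsSplit G
proposition27 n G ces with any? (λ v → simplicial? G v ×-dec simplicial? (complement G) v)
... | yes (v , sv , s̄v) = split-by G {P = InClosedNbhd G v} (inClosedNbhd? G v) sv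
      (λ a b a∉ b∉ → s̄v a b (outside⇒complementNbhd G a∉) (outside⇒complementNbhd G b∉))
... | no none = split-by G {P = ¬_ ∘ Simplicial G} (¬? ∘ simplicial? G) (nonSimplicial-adjacent G ces)
      (λ a b ¬¬sa ¬¬sb → nonSimplicial-adjacent (complement G)
                           (capEdgeSimplicial-complement {G = G} ces) a b (notBoth ¬¬sa) (notBoth ¬¬sb))
  where
  notBoth : ∀ {a} → ¬ ¬ Simplicial G a → ¬ Simplicial (complement G) a
  notBoth {a} ¬¬sa s̄a = none (a , decidable-stable (simplicial? G a) ¬¬sa , s̄a)
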